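{- Let $p$ be an odd prime and let $H,N$ be integers with $0\le H<H+N<p$. For $a\in\mathbb{F}_p^*$ let $F(a,H,N)$ be the number of integers $n$ with $H+1\le n\le H+N$ and $n!\equiv a\pmod p$. Then $$\max_{a\in\mathbb{F}_p^*}F(a,H,N)\ll N^{2/3}.$$
   Context: The implied constant is absolute. -}

module Defs where

open import Data.Nat using (ℕ; suc; _+_; _!; _%_; NonZero)
open import Data.Nat.Properties using (_≟_)
open import Data.List using (List; length; filter; map; upTo)

interval : ℕ → ℕ → List ℕ
interval H N = map (λ i → H + suc i) (upTo N)

-- F(a,H,N) = #{ n : H+1 ≤ n ≤ H+N , n! ≡ a (mod p) }, where the residue
-- class a ∈ F_p^* is represented by its least non-negative representative.
F : (p : ℕ) .{{_ : NonZero p}} → ℕ → ℕ → ℕ → ℕ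
F p a H N = length (filter (λ n → (n ! % p) ≟ a) (interval H N))

{-# OPTIONS --safe #-}
-- Let n₁ < ⋯ < n_F be the n ∈ (H, H + N] with n! ≡ a (mod p). If a gap n_{i+1} - n_i equals d,
-- then (n_i + 1)(n_i + 2)⋯(n_i + d) ≡ 1 (mod p), so n_i is a root mod p of a monic polynomial
-- of degree d; as the n_i are distinct residues, the gap d occurs at most d times. The F - 1
-- gaps sum to less than N, and a list of m positive integers in which each d occurs at most
-- d times has sum at least about m^{3/2}: with E = ⌊√m⌋, at most E²/2 entries are below E,
-- so the sum is at least E m / 2. Hence (F - 1)³ ≤ 16 N².
module Submission where

open import Defs
open import Data.Nat as ℕ using (ℕ; zero; suc; _≤_; _<_; _!; _%_; NonZero; z≤n; s≤s)
open import Data.Nat.Primality using (Prime)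
open import Data.List using (List; []; _∷_; length; map; filter)
open import Data.List.Relation.Unary.All as All using (All; []; _∷_)
open import Data.List.Relation.Unary.AllPairs as AllPairs using (AllPairs; []; _∷_)
open import Data.Product using (∃; ∃-syntax; _×_; _,_; proj₁; proj₂)
open import Function using (id; _∘_)
open import Relation.Nullary using (¬_; yes; no; contradiction)
open import Relation.Binary.PropositionalEquality

module Polynomials where

  open import Data.Integer as ℤ using (ℤ; +_; _+_; _-_; _*_)
  import Data.Integer.Properties as ℤ
  open import Data.Integer.Divisibility.Signed using (_∣_; ∣ᵤ⇒∣; ∣⇒∣ᵤ; ∣m+n∣m⇒∣n)
  open import Data.Integer.Tactic.RingSolver using (solve-∀)
  import Data.Nat.Divisibility as ℕ
  import Data.Nat.Properties as ℕ
  open import Data.Nat.Primality using (euclidsLemma)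
  open import Data.Sum as Sum using (_⊎_; [_,_]′)
  open import Data.Empty using (⊥-elim)

  -- f agrees with a polynomial of degree ≤ d whose x^d-coefficient is c. Rather than through
  -- coefficients, such functions are described by the factor theorem: for every r,
  -- f x = f r + (x - r) g x with g of the same kind in degree d - 1.
  Polynomial : ℕ → ℤ → (ℤ → ℤ) → Set
  Polynomial zero    c f = ∀ x → f x ≡ c
  Polynomial (suc d) c f = ∀ r → ∃[ g ] Polynomial d c g × (∀ x → f x ≡ f r + (x - r) * g x)

  Polynomial-+ : ∀ {d e c c′ f h} → e ≤ d → Polynomial (suc d) c f → Polynomial e c′ h →
                 Polynomial (suc d) c (λ x → f x + h x)
  Polynomial-+ {e = zero} {f = f} {h} _ pf ph r with pf r
  ... | g , pg , f≡ = g , pg , λ x → begin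
    f x + h x                     ≡⟨ cong₂ _+_ (f≡ x) (trans (ph x) (sym (ph r))) ⟩
    f r + (x - r) * g x + h r     ≡⟨ regroup (f r) (h r) (x - r) (g x) ⟩
    f r + h r + (x - r) * g x     ∎
    where
    open ≡-Reasoning
    regroup : ∀ a b u v → a + u * v + b ≡ a + b + u * v
    regroup = solve-∀
  Polynomial-+ {suc d} {suc e} {f = f} {h} (s≤s e≤d) pf ph r with pf r | ph r
  ... | g , pg , f≡ | k , pk , h≡ = (λ x → g x + k x) , Polynomial-+ e≤d pg pk , λ x → begin
    f x + h x                                     ≡⟨ cong₂ _+_ (f≡ x) (h≡ x) ⟩
    f r + (x - r) * g x + (h r + (x - r) * k x)   ≡⟨ regroup (f r) (h r) (x - r) (g x) (k x) ⟩
    f r + h r + (x - r) * (g x + k x)             ∎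
    where
    open ≡-Reasoning
    regroup : ∀ a b u v w → a + u * v + (b + u * w) ≡ a + b + u * (v + w)
    regroup = solve-∀

  Polynomial-scale : ∀ {d c f} k → Polynomial d c f → Polynomial d (k * c) (λ x → k * f x)
  Polynomial-scale {zero} k pf x = cong (k *_) (pf x)
  Polynomial-scale {suc d} {f = f} k pf r with pf r
  ... | g , pg , f≡ = (λ x → k * g x) , Polynomial-scale k pg , λ x → begin
    k * f x                   ≡⟨ cong (k *_) (f≡ x) ⟩
    k * (f r + (x - r) * g x) ≡⟨ distrib k (f r) (x - r) (g x) ⟩
    k * f r + (x - r) * (k * g x) ∎
    where
    open ≡-Reasoning
    distrib : ∀ k a u v → k * (a + u * v) ≡ k * a + u * (k * v)
    distrib = solve-∀

  private
    split-+ : ∀ x k r c → (x + k) * c ≡ (r + k) * c + (x - r) * c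
    split-+ = solve-∀

  Polynomial-*-linear : ∀ {d c f} k → Polynomial d c f → Polynomial (suc d) c (λ x → (x + k) * f x)
  Polynomial-*-linear {zero} {c} {f} k pf r = (λ _ → c) , (λ _ → refl) , λ x → begin
    (x + k) * f x                   ≡⟨ split-+ x k r (f x) ⟩
    (r + k) * f x + (x - r) * f x   ≡⟨ cong₂ (λ s t → (r + k) * s + (x - r) * t)
                                             (trans (pf x) (sym (pf r))) (pf x) ⟩
    (r + k) * f r + (x - r) * c     ∎
    where open ≡-Reasoning
  Polynomial-*-linear {suc d} {f = f} k pf r with pf r
  ... | g , pg , f≡ = (λ x → f x + (r + k) * g x)
                    , Polynomial-+ ℕ.≤-refl pf (Polynomial-scale (r + k) pg)
                    , λ x → begin
    (x + k) * f x                                     ≡⟨ split-+ x k r (f x) ⟩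
    (r + k) * f x + (x - r) * f x                     ≡⟨ cong (λ t → (r + k) * t + (x - r) * f x) (f≡ x) ⟩
    (r + k) * (f r + (x - r) * g x) + (x - r) * f x   ≡⟨ regroup (r + k) (f r) (x - r) (g x) (f x) ⟩
    (r + k) * f r + (x - r) * (f x + (r + k) * g x)   ∎
    where
    open ≡-Reasoning
    regroup : ∀ a b u v w → a * (b + u * v) + u * w ≡ a * b + u * (w + a * v)
    regroup = solve-∀

  module _ {p : ℕ} (p-prime : Prime p) where

    euclidsLemmaℤ : ∀ i j → + p ∣ i * j → + p ∣ i ⊎ + p ∣ j
    euclidsLemmaℤ i j p∣ij = Sum.map ∣ᵤ⇒∣ ∣ᵤ⇒∣
      (euclidsLemma ℤ.∣ i ∣ ℤ.∣ j ∣ p-prime (subst (p ℕ.∣_) (ℤ.abs-* i j) (∣⇒∣ᵤ p∣ij)))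

    length-roots≤degree : ∀ d {c f} → ¬ (+ p ∣ c) → Polynomial d c f →
                          ∀ {xs} → AllPairs (λ r s → ¬ (+ p ∣ s - r)) xs → All (λ x → + p ∣ f x) xs →
                          length xs ≤ d
    length-roots≤degree d _ _ [] [] = z≤n
    length-roots≤degree zero p∤c pf {x ∷ _} _ (p∣fx ∷ _) = contradiction (subst (+ p ∣_) (pf x) p∣fx) p∤c
    length-roots≤degree (suc d) {f = f} p∤c pf {r ∷ _} (r≢xs ∷ distinct) (p∣fr ∷ p∣fxs) with pf r
    ... | g , pg , f≡ = s≤s (length-roots≤degree d p∤c pg distinct (All.zipWith root-of-g (r≢xs , p∣fxs)))
      where
      root-of-g : ∀ {s} → ¬ (+ p ∣ s - r) × + p ∣ f s → + p ∣ g s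
      root-of-g {s} (r≢s , p∣fs) =
        [ ⊥-elim ∘ r≢s , id ]′
          (euclidsLemmaℤ (s - r) (g s) (∣m+n∣m⇒∣n (subst (+ p ∣_) (f≡ s) p∣fs) p∣fr))

module FactorialsModPrime where

  open Polynomials
  open import Data.Integer as ℤ using (ℤ; +_; _+_; _-_; _*_)
  import Data.Integer.Properties as ℤ
  open import Data.Integer.Divisibility.Signed using (_∣_; divides; ∣⇒∣ᵤ)
  open import Data.Integer.Tactic.RingSolver using (solve-∀)
  import Data.Nat.Properties as ℕ
  import Data.Nat.DivMod as ℕ
  open import Data.List.Properties using (length-map)
  import Data.List.Relation.Unary.All.Properties as All
  import Data.List.Relation.Unary.AllPairs.Properties as AllPairs
  open import Data.Nat using (_/_)
  open import Data.Nat.Divisibility as ℕ using (>⇒∤)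
  open import Data.Nat.Primality using (euclidsLemma; prime⇒nonTrivial)
  open import Data.Sum using ([_,_]′)
  open import Data.Empty using (⊥-elim)

  risingProduct : ℕ → ℤ → ℤ
  risingProduct zero    z = + 1
  risingProduct (suc d) z = (z + + suc d) * risingProduct d z

  risingProduct-monic : ∀ d → Polynomial d (+ 1) (risingProduct d)
  risingProduct-monic zero    _ = refl
  risingProduct-monic (suc d)   = Polynomial-*-linear (+ suc d) (risingProduct-monic d)

  factorial-+ : ∀ x d → + ((x ℕ.+ d) !) ≡ risingProduct d (+ x) * + (x !)
  factorial-+ x zero = begin
    + ((x ℕ.+ 0) !)     ≡⟨ cong (λ n → + (n !)) (ℕ.+-identityʳ x) ⟩
    + (x !)             ≡⟨ ℤ.*-identityˡ (+ (x !)) ⟨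
    + 1 * + (x !)       ∎
    where open ≡-Reasoning
  factorial-+ x (suc d) = begin
    + ((x ℕ.+ suc d) !)                 ≡⟨ cong (λ n → + (n !)) (ℕ.+-suc x d) ⟩
    + (suc (x ℕ.+ d) ℕ.* (x ℕ.+ d) !)   ≡⟨ ℤ.pos-* (suc (x ℕ.+ d)) ((x ℕ.+ d) !) ⟩
    + suc (x ℕ.+ d) * + ((x ℕ.+ d) !)   ≡⟨ cong₂ _*_ x+[1+d] (factorial-+ x d) ⟩
    (+ x + + suc d) * (P * X)           ≡⟨ ℤ.*-assoc (+ x + + suc d) P X ⟨
    risingProduct (suc d) (+ x) * X     ∎
    where
    open ≡-Reasoning
    P = risingProduct d (+ x)
    X = + (x !)
    x+[1+d] : + suc (x ℕ.+ d) ≡ + x + + suc d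
    x+[1+d] = trans (cong +_ (sym (ℕ.+-suc x d))) (ℤ.pos-+ x (suc d))

  RisingRoot : ℕ → ℕ → ℕ → Set
  RisingRoot p d x = + p ∣ risingProduct d (+ x) - + 1

  Incongruent : ℕ → ℕ → ℕ → Set
  Incongruent p r s = ¬ (+ p ∣ + s - + r)

  module _ {p : ℕ} .{{_ : NonZero p}} (p-prime : Prime p) where

    1<p : 1 < p
    1<p = ℕ.nonTrivial⇒n>1 p {{prime⇒nonTrivial p-prime}}

    p∤n! : ∀ {n} → n < p → ¬ (p ℕ.∣ n !)
    p∤n! {zero}  _   = >⇒∤ 1<p
    p∤n! {suc n} n<p = [ >⇒∤ n<p , p∤n! (ℕ.<-trans (ℕ.n<1+n n) n<p) ]′
                     ∘ euclidsLemma (suc n) (n !) p-prime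

    %-≡⇒∣- : ∀ m n → m % p ≡ n % p → + p ∣ + m - + n
    %-≡⇒∣- m n m%p≡n%p = divides (M - N′) (begin
      + m - + n                                 ≡⟨ cong₂ _-_ (trans (expand m) (cong (λ r → + r + M * P) m%p≡n%p))
                                                             (expand n) ⟩
      + (n % p) + M * P - (+ (n % p) + N′ * P)  ≡⟨ cancel (+ (n % p)) M N′ P ⟩
      (M - N′) * P                              ∎)
      where
      open ≡-Reasoning
      M = + (m / p)
      N′ = + (n / p)
      P = + p
      expand : ∀ k → + k ≡ + (k % p) + + (k / p) * P
      expand k = begin
        + k                           ≡⟨ cong +_ (ℕ.m≡m%n+[m/n]*n k p) ⟩
        + (k % p ℕ.+ k / p ℕ.* p)     ≡⟨ ℤ.pos-+ (k % p) (k / p ℕ.* p) ⟩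
        + (k % p) + + (k / p ℕ.* p)   ≡⟨ cong (_+_ (+ (k % p))) (ℤ.pos-* (k / p) p) ⟩
        + (k % p) + + (k / p) * P     ∎
      cancel : ∀ r a b q → r + a * q - (r + b * q) ≡ (a - b) * q
      cancel = solve-∀

    <⇒incongruent : ∀ {r s} → r < s → s < p → Incongruent p r s
    <⇒incongruent {r} {s} r<s s<p p∣s-r =
      >⇒∤ {{ℕ.>-nonZero (ℕ.m<n⇒0<n∸m r<s)}} (ℕ.≤-<-trans (ℕ.m∸n≤m s r) s<p)
        (subst (p ℕ.∣_) (cong ℤ.∣_∣ s-r≡s∸r) (∣⇒∣ᵤ p∣s-r))
      where
      s-r≡s∸r : + s - + r ≡ + (s ℕ.∸ r)
      s-r≡s∸r = trans (ℤ.m-n≡m⊖n s r) (ℤ.⊖-≥ (ℕ.<⇒≤ r<s))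

    risingProduct-root : ∀ {x y} → x ≤ y → y < p → x ! % p ≡ y ! % p → RisingRoot p (y ℕ.∸ x) x
    risingProduct-root {x} {y} x≤y y<p x!≡y! =
      [ ⊥-elim ∘ p∤n! (ℕ.≤-<-trans x≤y y<p) ∘ ∣⇒∣ᵤ , id ]′
        (euclidsLemmaℤ p-prime (+ (x !)) (risingProduct d (+ x) - + 1)
          (subst (+ p ∣_) factor (%-≡⇒∣- (y !) (x !) (sym x!≡y!))))
      where
      d = y ℕ.∸ x
      factor : + (y !) - + (x !) ≡ + (x !) * (risingProduct d (+ x) - + 1)
      factor = begin
        + (y !) - + (x !)                           ≡⟨ cong (λ n → + (n !) - + (x !)) (ℕ.m+[n∸m]≡n x≤y) ⟨
        + ((x ℕ.+ d) !) - + (x !)                   ≡⟨ cong (_- + (x !)) (factorial-+ x d) ⟩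
        risingProduct d (+ x) * + (x !) - + (x !)   ≡⟨ pull (risingProduct d (+ x)) (+ (x !)) ⟩
        + (x !) * (risingProduct d (+ x) - + 1)     ∎
        where
        open ≡-Reasoning
        pull : ∀ P X → P * X - X ≡ X * (P - + 1)
        pull = solve-∀

    length-risingRoots≤ : ∀ d {xs} → AllPairs (Incongruent p) xs → All (RisingRoot p (suc d)) xs →
                          length xs ≤ suc d
    length-risingRoots≤ d {xs} incongruent roots = begin
      length xs           ≡⟨ length-map +_ xs ⟨
      length (map +_ xs)  ≤⟨ length-roots≤degree p-prime (suc d) p∤1 monic
                               (AllPairs.map⁺ incongruent) (All.map⁺ roots) ⟩
      suc d               ∎
      where
      open ℕ.≤-Reasoning
      p∤1 : ¬ (+ p ∣ + 1)
      p∤1 = >⇒∤ 1<p ∘ ∣⇒∣ᵤ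
      monic : Polynomial (suc d) (+ 1) (λ z → risingProduct (suc d) z - + 1)
      monic = Polynomial-+ z≤n (risingProduct-monic (suc d)) (λ _ → refl)

open FactorialsModPrime using (RisingRoot; Incongruent; <⇒incongruent; risingProduct-root; length-risingRoots≤)
open import Data.Nat using (_+_; _*_; _^_; _∸_; s≤s⁻¹; z<s)
open import Data.Nat.Properties
open import Data.Nat.Tactic.RingSolver using (solve-∀)
open import Data.Nat.ListAction using (sum)
open import Data.List.Relation.Unary.Linked as Linked using (Linked; [-]; _∷_)
open import Data.List.Relation.Unary.Linked.Properties using (AllPairs⇒Linked)
open import Data.List.Relation.Binary.Sublist.Propositional using (_⊆_; []; _∷_; _∷ʳ_)
open import Data.List.Relation.Binary.Sublist.Propositional.Properties using (All-resp-⊆)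
open import Relation.Unary using (Decidable)
import Data.List.Relation.Unary.All.Properties as All
import Data.List.Relation.Unary.AllPairs.Properties as AllPairs

AllPairs-resp-⊆ : ∀ {A : Set} {R : A → A → Set} {xs ys} → xs ⊆ ys → AllPairs R ys → AllPairs R xs
AllPairs-resp-⊆ []             []         = []
AllPairs-resp-⊆ (_ ∷ʳ xs⊆ys)   (_ ∷ rys)  = AllPairs-resp-⊆ xs⊆ys rys
AllPairs-resp-⊆ (refl ∷ xs⊆ys) (ry ∷ rys) = All-resp-⊆ xs⊆ys ry ∷ AllPairs-resp-⊆ xs⊆ys rys

AllPairs-zipWith-All : ∀ {A : Set} {P : A → Set} {R Q : A → A → Set} →
                       (∀ {x y} → P x → P y → R x y → Q x y) →
                       ∀ {xs} → All P xs → AllPairs R xs → AllPairs Q xs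
AllPairs-zipWith-All f []         []           = []
AllPairs-zipWith-All f (px ∷ pxs) (rxs ∷ rxss) =
  All.zipWith (λ (py , rxy) → f px py rxy) (pxs , rxs) ∷ AllPairs-zipWith-All f pxs rxss

count : ∀ {A : Set} {P : A → Set} → Decidable P → List A → ℕ
count P? []       = 0
count P? (x ∷ xs) with P? x
... | yes _ = suc (count P? xs)
... | no  _ = count P? xs

multiplicity : ℕ → List ℕ → ℕ
multiplicity d = count (_≟ d)

countBelow : ℕ → List ℕ → ℕ
countBelow E = count (_<? E)

gaps : ℕ → List ℕ → List ℕ
gaps x []       = []
gaps x (y ∷ xs) = y ∸ x ∷ gaps y xs

gapStarts : ℕ → ℕ → List ℕ → List ℕ
gapStarts d x []       = []
gapStarts d x (y ∷ xs) with y ∸ x ≟ d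
... | yes _ = x ∷ gapStarts d y xs
... | no  _ = gapStarts d y xs

length-gaps : ∀ x xs → length (gaps x xs) ≡ length xs
length-gaps x []       = refl
length-gaps x (y ∷ xs) = cong suc (length-gaps y xs)

x+sum-gaps≤hi : ∀ {hi x xs} → Linked _≤_ (x ∷ xs) → All (_≤ hi) (x ∷ xs) → x + sum (gaps x xs) ≤ hi
x+sum-gaps≤hi {x = x} [-] (x≤hi ∷ []) = ≤-trans (≤-reflexive (+-identityʳ x)) x≤hi
x+sum-gaps≤hi {hi} {x} {y ∷ xs} (x≤y ∷ linked) (_ ∷ bounded) = begin
  x + (y ∸ x + sum (gaps y xs))   ≡⟨ +-assoc x (y ∸ x) _ ⟨
  x + (y ∸ x) + sum (gaps y xs)   ≡⟨ cong (_+ sum (gaps y xs)) (m+[n∸m]≡n x≤y) ⟩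
  y + sum (gaps y xs)             ≤⟨ x+sum-gaps≤hi linked bounded ⟩
  hi                              ∎
  where open ≤-Reasoning

multiplicity-gaps : ∀ d x xs → multiplicity d (gaps x xs) ≡ length (gapStarts d x xs)
multiplicity-gaps d x []       = refl
multiplicity-gaps d x (y ∷ xs) with y ∸ x ≟ d
... | yes _ = cong suc (multiplicity-gaps d y xs)
... | no  _ = multiplicity-gaps d y xs

gapStarts-⊆ : ∀ d x xs → gapStarts d x xs ⊆ x ∷ xs
gapStarts-⊆ d x []       = x ∷ʳ []
gapStarts-⊆ d x (y ∷ xs) with y ∸ x ≟ d
... | yes _ = refl ∷ gapStarts-⊆ d y xs
... | no  _ = x ∷ʳ gapStarts-⊆ d y xs

All-gapStarts : ∀ {P : ℕ → ℕ → Set} d {x xs} → Linked (λ x y → P (y ∸ x) x) (x ∷ xs) →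
                All (P d) (gapStarts d x xs)
All-gapStarts d [-] = []
All-gapStarts {P} d {x} {y ∷ _} (Pxy ∷ linked) with y ∸ x ≟ d
... | yes refl = Pxy ∷ All-gapStarts {P} d linked
... | no  _    = All-gapStarts {P} d linked

countBelow-zero : ∀ gs → countBelow 0 gs ≡ 0
countBelow-zero []       = refl
countBelow-zero (_ ∷ gs) = countBelow-zero gs

countBelow-suc : ∀ E gs → countBelow (suc E) gs ≡ countBelow E gs + multiplicity E gs
countBelow-suc E []       = refl
countBelow-suc E (g ∷ gs) with g <? suc E | g <? E | g ≟ E
... | yes _   | yes g<E | yes refl = contradiction g<E (n≮n g)
... | yes _   | yes _   | no  _    = cong suc (countBelow-suc E gs)
... | yes _   | no  _   | yes _    = trans (cong suc (countBelow-suc E gs)) (sym (+-suc _ _))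
... | yes g≤E | no  g≮E | no  g≢E  = contradiction (≤∧≢⇒< (s≤s⁻¹ g≤E) g≢E) g≮E
... | no  g≰E | yes g<E | _        = contradiction (m<n⇒m<1+n g<E) g≰E
... | no  g≰g | no  _   | yes refl = contradiction (n<1+n g) g≰g
... | no  _   | no  _   | no  _    = countBelow-suc E gs

2*countBelow≤E*E : ∀ gs → (∀ d → multiplicity d gs ≤ d) → ∀ E → 2 * countBelow E gs ≤ E * E
2*countBelow≤E*E gs _ zero = ≤-reflexive (cong (2 *_) (countBelow-zero gs))
2*countBelow≤E*E gs multiplicity≤ (suc E) = begin
  2 * countBelow (suc E) gs                     ≡⟨ cong (2 *_) (countBelow-suc E gs) ⟩
  2 * (countBelow E gs + multiplicity E gs)     ≡⟨ *-distribˡ-+ 2 (countBelow E gs) _ ⟩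
  2 * countBelow E gs + 2 * multiplicity E gs   ≤⟨ +-mono-≤ (2*countBelow≤E*E gs multiplicity≤ E)
                                                            (*-monoʳ-≤ 2 (multiplicity≤ E)) ⟩
  E * E + 2 * E                                 <⟨ n<1+n _ ⟩
  suc (E * E + 2 * E)                           ≡⟨ square-suc E ⟩
  suc E * suc E                                 ∎
  where
  open ≤-Reasoning
  square-suc : ∀ E → suc (E * E + 2 * E) ≡ suc E * suc E
  square-suc = solve-∀

E*length≤sum+E*countBelow : ∀ E gs → E * length gs ≤ sum gs + E * countBelow E gs
E*length≤sum+E*countBelow E []       = ≤-refl
E*length≤sum+E*countBelow E (g ∷ gs) with g <? E | E*length≤sum+E*countBelow E gs
... | yes _   | ih = begin
  E * suc (length gs)                       ≡⟨ *-suc E (length gs) ⟩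
  E + E * length gs                         ≤⟨ +-monoʳ-≤ E ih ⟩
  E + (sum gs + E * countBelow E gs)        ≡⟨ regroup E (sum gs) (countBelow E gs) ⟩
  sum gs + E * suc (countBelow E gs)        ≤⟨ +-monoˡ-≤ _ (m≤n+m (sum gs) g) ⟩
  g + sum gs + E * suc (countBelow E gs)    ∎
  where
  open ≤-Reasoning
  regroup : ∀ E S c → E + (S + E * c) ≡ S + E * suc c
  regroup = solve-∀
... | no  g≮E | ih = begin
  E * suc (length gs)                       ≡⟨ *-suc E (length gs) ⟩
  E + E * length gs                         ≤⟨ +-mono-≤ (≮⇒≥ g≮E) ih ⟩
  g + (sum gs + E * countBelow E gs)        ≡⟨ +-assoc g (sum gs) _ ⟨
  g + sum gs + E * countBelow E gs          ∎
  where open ≤-Reasoning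

E*length≤2*sum : ∀ gs → (∀ d → multiplicity d gs ≤ d) → ∀ E → E * E ≤ length gs →
                 E * length gs ≤ 2 * sum gs
E*length≤2*sum gs multiplicity≤ E E²≤m = +-cancelʳ-≤ (E * m) (E * m) (2 * S) (begin
  E * m + E * m         ≡⟨ double (E * m) ⟩
  2 * (E * m)           ≤⟨ *-monoʳ-≤ 2 (E*length≤sum+E*countBelow E gs) ⟩
  2 * (S + E * c)       ≡⟨ regroup S E c ⟩
  2 * S + E * (2 * c)   ≤⟨ +-monoʳ-≤ (2 * S) (*-monoʳ-≤ E 2c≤m) ⟩
  2 * S + E * m         ∎)
  where
  open ≤-Reasoning
  m = length gs
  S = sum gs
  c = countBelow E gs
  2c≤m : 2 * c ≤ m
  2c≤m = ≤-trans (2*countBelow≤E*E gs multiplicity≤ E) E²≤m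
  double : ∀ n → n + n ≡ 2 * n
  double = solve-∀
  regroup : ∀ S E c → 2 * (S + E * c) ≡ 2 * S + E * (2 * c)
  regroup = solve-∀

floorSqrt : ∀ m → ∃[ E ] E * E ≤ m × m < suc E * suc E
floorSqrt zero = 0 , z≤n , s≤s z≤n
floorSqrt (suc m) with floorSqrt m
... | E , E²≤m , m<E'² with suc m <? suc E * suc E
...   | yes m'<E'² = E , m≤n⇒m≤1+n E²≤m , m'<E'²
...   | no  m'≮E'² = suc E , ≮⇒≥ m'≮E'² , (begin-strict
  suc m                       ≤⟨ m<E'² ⟩
  suc E * suc E               <⟨ *-mono-< (n<1+n (suc E)) (n<1+n (suc E)) ⟩
  suc (suc E) * suc (suc E)   ∎)
  where open ≤-Reasoning

m³≤16*S² : ∀ E m S → m < suc E * suc E → E * m ≤ 2 * S → m ^ 3 ≤ 16 * S ^ 2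
m³≤16*S² zero zero    _ _        _ = z≤n
m³≤16*S² zero (suc _) _ (s≤s ()) _
m³≤16*S² E@(suc _) m S m<E'² Em≤2S = begin
  m ^ 3                     ≡⟨ cube m ⟩
  m * (m * m)               ≤⟨ *-monoˡ-≤ (m * m) m≤4E² ⟩
  4 * (E * E) * (m * m)     ≡⟨ regroup E m ⟩
  4 * ((E * m) * (E * m))   ≤⟨ *-monoʳ-≤ 4 (*-mono-≤ Em≤2S Em≤2S) ⟩
  4 * ((2 * S) * (2 * S))   ≡⟨ constant S ⟩
  16 * S ^ 2                ∎
  where
  open ≤-Reasoning
  cube : ∀ m → m * (m * (m * 1)) ≡ m * (m * m)
  cube = solve-∀
  regroup : ∀ E m → 4 * (E * E) * (m * m) ≡ 4 * ((E * m) * (E * m))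
  regroup = solve-∀
  constant : ∀ S → 4 * ((2 * S) * (2 * S)) ≡ 16 * (S * (S * 1))
  constant = solve-∀
  double : ∀ E → (E + E) * (E + E) ≡ 4 * (E * E)
  double = solve-∀
  E'≤2E : suc E ≤ E + E
  E'≤2E = +-monoˡ-≤ E (s≤s z≤n)
  m≤4E² : m ≤ 4 * (E * E)
  m≤4E² = begin
    m                   ≤⟨ <⇒≤ m<E'² ⟩
    suc E * suc E       ≤⟨ *-mono-≤ E'≤2E E'≤2E ⟩
    (E + E) * (E + E)   ≡⟨ double E ⟩
    4 * (E * E)         ∎

length³≤16*sum² : ∀ gs → (∀ d → multiplicity d gs ≤ d) → length gs ^ 3 ≤ 16 * sum gs ^ 2
length³≤16*sum² gs multiplicity≤ with floorSqrt (length gs)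
... | E , E²≤m , m<E'² =
  m³≤16*S² E (length gs) (sum gs) m<E'² (E*length≤2*sum gs multiplicity≤ E E²≤m)

[1+m]³≤128*N² : ∀ m s N → m ^ 3 ≤ 16 * s ^ 2 → s < N → suc m ^ 3 ≤ 128 * N ^ 2
[1+m]³≤128*N² zero        _ (suc _) _ _ = s≤s z≤n
[1+m]³≤128*N² m@(suc _) s N m³≤16s² s<N = begin
  suc m ^ 3          ≤⟨ ^-monoˡ-≤ 3 m'≤2m ⟩
  (m + m) ^ 3        ≡⟨ cube-double m ⟩
  8 * m ^ 3          ≤⟨ *-monoʳ-≤ 8 m³≤16s² ⟩
  8 * (16 * s ^ 2)   ≡⟨ *-assoc 8 16 (s ^ 2) ⟨
  128 * s ^ 2        ≤⟨ *-monoʳ-≤ 128 (^-monoˡ-≤ 2 (<⇒≤ s<N)) ⟩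
  128 * N ^ 2        ∎
  where
  open ≤-Reasoning
  m'≤2m : suc m ≤ m + m
  m'≤2m = +-monoˡ-≤ m (s≤s z≤n)
  cube-double : ∀ m → (m + m) * ((m + m) * ((m + m) * 1)) ≡ 8 * (m * (m * (m * 1)))
  cube-double = solve-∀

length³≤128*N² : ∀ {H N x xs} → Linked _≤_ (x ∷ xs) → H < x → All (_≤ H + N) (x ∷ xs) →
                 (∀ d → multiplicity d (gaps x xs) ≤ d) → length (x ∷ xs) ^ 3 ≤ 128 * N ^ 2
length³≤128*N² {H} {N} {x} {xs} linked H<x bounded multiplicity≤ =
  subst (λ m → suc m ^ 3 ≤ 128 * N ^ 2) (length-gaps x xs)
        ([1+m]³≤128*N² (length (gaps x xs)) s N (length³≤16*sum² (gaps x xs) multiplicity≤) s<N)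
  where
  open ≤-Reasoning
  s = sum (gaps x xs)
  s<N : s < N
  s<N = +-cancelˡ-≤ H (suc s) N (begin
    H + suc s   ≡⟨ +-suc H s ⟩
    suc H + s   ≤⟨ +-monoˡ-≤ s H<x ⟩
    x + s       ≤⟨ x+sum-gaps≤hi linked bounded ⟩
    H + N       ∎)

module _ {p : ℕ} .{{_ : NonZero p}} (p-prime : Prime p) {a : ℕ} where

  gap-multiplicity≤ : ∀ {x xs} → AllPairs _<_ (x ∷ xs) → All (λ n → n < p × n ! % p ≡ a) (x ∷ xs) →
                      ∀ d → multiplicity d (gaps x xs) ≤ d
  gap-multiplicity≤ {x} {xs} sorted solutions d = begin
    multiplicity d (gaps x xs)   ≡⟨ multiplicity-gaps d x xs ⟩
    length (gapStarts d x xs)    ≤⟨ bound d (AllPairs-resp-⊆ (gapStarts-⊆ d x xs) incongruent)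
                                            (All-gapStarts {GapRoot} d consecutive) ⟩
    d                            ∎
    where
    open ≤-Reasoning
    GapRoot : ℕ → ℕ → Set
    GapRoot d x = 0 < d × RisingRoot p d x
    incongruent : AllPairs (Incongruent p) (x ∷ xs)
    incongruent = AllPairs-zipWith-All (λ _ (s<p , _) r<s → <⇒incongruent p-prime r<s s<p) solutions sorted
    consecutive : Linked (λ x y → GapRoot (y ∸ x) x) (x ∷ xs)
    consecutive = AllPairs⇒Linked (AllPairs-zipWith-All
      (λ (_ , x!≡a) (y<p , y!≡a) x<y →
         m<n⇒0<n∸m x<y , risingProduct-root p-prime (<⇒≤ x<y) y<p (trans x!≡a (sym y!≡a)))
      solutions sorted)
    bound : ∀ d {ys} → AllPairs (Incongruent p) ys → All (GapRoot d) ys → length ys ≤ d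
    bound zero    _        []             = z≤n
    bound zero    _        ((() , _) ∷ _)
    bound (suc d) distinct roots          = length-risingRoots≤ p-prime d distinct (All.map proj₂ roots)

interval-sorted : ∀ H N → AllPairs _<_ (interval H N)
interval-sorted H N = AllPairs.map⁺ (AllPairs.applyUpTo⁺₁ id N λ i<j _ → +-monoʳ-< H (s≤s i<j))

interval-bounded : ∀ H N → All (λ n → H < n × n ≤ H + N) (interval H N)
interval-bounded H N = All.map⁺ (All.applyUpTo⁺₁ id N λ i<N → m<m+n H z<s , +-monoʳ-≤ H i<N)

F³≤128*N² : ∀ {p} .{{_ : NonZero p}} → Prime p → ∀ H N → H + N < p → ∀ a → F p a H N ^ 3 ≤ 128 * N ^ 2
F³≤128*N² {p} p-prime H N H+N<p a =
  bound (filter (λ n → n ! % p ≟ a) (interval H N))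
        (AllPairs.filter⁺ _ (interval-sorted H N))
        (All.zip (All.filter⁺ _ (interval-bounded H N) , All.all-filter _ (interval H N)))
  where
  bound : ∀ xs → AllPairs _<_ xs → All (λ n → (H < n × n ≤ H + N) × n ! % p ≡ a) xs →
          length xs ^ 3 ≤ 128 * N ^ 2
  bound []       _      _ = z≤n
  bound (x ∷ xs) sorted solutions@(((H<x , _) , _) ∷ _) =
    length³≤128*N² (Linked.map <⇒≤ (AllPairs⇒Linked sorted)) H<x (All.map (proj₂ ∘ proj₁) solutions)
      (gap-multiplicity≤ p-prime sorted
        (All.map (λ ((_ , n≤H+N) , n!≡a) → ≤-<-trans n≤H+N H+N<p , n!≡a) solutions))

theorem12 : ∃ λ (C : ℕ) →
    (p : ℕ) .{{_ : NonZero p}} → Prime p → ¬ (p ≡ 2) →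
    (H N : ℕ) → H + N < p →
    (a : ℕ) → 1 ≤ a → a < p →
    F p a H N ^ 3 ≤ C * N ^ 2
theorem12 = 128 , λ p {{_}} p-prime _ H N H+N<p a _ _ → F³≤128*N² p-prime H N H+N<p a
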